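{- There is a computable reduction from Problem B to Problem C, where: Problem B: given variables $q_0,q_1,\dots,q_n$ and a finite set of equations of which at most one is of the form $\sum_{i\in I}\alpha_iq_i=0$ ($I\subseteq\{0,\dots,n\}$, $\alpha_i\in\mathbb{Q}$) and all others are of the form $q_iq_j=q_kq_\ell$ ($i,j,k,\ell\in\{0,\dots,n\}$), decide whether there is a rational solution with $1\le q_0\le q_i$ for every $i=1,\dots,n$. Problem C: given variables $Q=\{q_1,\dots,q_n\}$, $P=\{p_1,\dots,p_n\}$ and a finite set of equations each of one of the forms (a) $\sum_{i\in I}\alpha_iq_i=0$ for some $I\subseteq\{1,\dots,n\}$ and rationals $\alpha_i$; (b) $q_ip_j=q_kp_\ell$ for some $i,j,k,\ell\in\{1,\dots,n\}$; (c) $q_i=\frac12\sum_{j=1}^nq_j$ for some $i$; (d) $p_i=\frac12\sum_{j=1}^np_j$ for some $i$; decide whether there is a rational solution satisfying $q_1\le q_i$ for $i=1,\dots,n$, $q_i,p_i\ge1$ for $i=1,\dots,n$, and $\sum_{i=1}^np_i=\sum_{i=1}^nq_i$.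
   Context: A computable reduction from one problem to another is an algorithm transforming each instance of the first problem into an instance of the second such that the first has a solution if and only if the second does. -}

module Defs where

open import Data.Nat using (ℕ; zero; suc)
open import Data.Fin using (Fin; zero; suc)
open import Data.Vec using (Vec; lookup)
open import Data.List using (List)
open import Data.List.Relation.Unary.All using (All)
open import Data.Maybe using (Maybe; just; nothing)
open import Data.Product using (Σ; _×_)
open import Data.Unit using (⊤)
open import Data.Rational using (ℚ; 0ℚ; 1ℚ; ½; _+_; _*_; _≤_)
open import Relation.Binary.PropositionalEquality using (_≡_)

sumℚ : ∀ {n} → (Fin n → ℚ) → ℚ
sumℚ {zero}  f = 0ℚ
sumℚ {suc n} f = f zero + sumℚ (λ i → f (suc i))

-- A linear equation Σ_{i∈I} α_i x_i = 0 over variables indexed by Fin n,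
-- given by its coefficient vector (α_i = 0 for i ∉ I).
LinEq : ℕ → Set
LinEq n = Vec ℚ n

holdsLin : ∀ {n} → LinEq n → (Fin n → ℚ) → Set
holdsLin α x = sumℚ (λ i → lookup α i * x i) ≡ 0ℚ

-- Problem B.  Variables q_0 … q_n  (indexed by Fin (suc n), q_0 = zero).

record QuadEq (m : ℕ) : Set where
  constructor quad
  field
    i j k l : Fin m

holdsQuad : ∀ {m} → QuadEq m → (Fin m → ℚ) → Set
holdsQuad (quad i j k l) q = q i * q j ≡ q k * q l

record InstanceB : Set where
  constructor instB
  field
    n     : ℕ
    lin   : Maybe (LinEq (suc n))
    quads : List (QuadEq (suc n))

holdsMaybeLin : ∀ {m} → Maybe (LinEq m) → (Fin m → ℚ) → Set
holdsMaybeLin nothing  q = ⊤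
holdsMaybeLin (just α) q = holdsLin α q

SolutionB : (x : InstanceB) → (Fin (suc (InstanceB.n x)) → ℚ) → Set
SolutionB (instB n lin quads) q =
  holdsMaybeLin lin q
  × All (λ e → holdsQuad e q) quads
  × (1ℚ ≤ q zero)
  × (∀ (i : Fin (suc n)) → q zero ≤ q i)

SolvableB : InstanceB → Set
SolvableB x = Σ (Fin (suc (InstanceB.n x)) → ℚ) (SolutionB x)

-- Problem C.  Variables q_1 … q_n and p_1 … p_n (each indexed by Fin n).

data CEq (n : ℕ) : Set where
  linQ  : LinEq n → CEq n
  mulQP : (i j k l : Fin n) → CEq n
  halfQ : Fin n → CEq n
  halfP : Fin n → CEq n

holdsC : ∀ {n} → CEq n → (Fin n → ℚ) → (Fin n → ℚ) → Set
holdsC (linQ α)        q p = holdsLin α q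
holdsC (mulQP i j k l) q p = q i * p j ≡ q k * p l
holdsC (halfQ i)       q p = q i ≡ ½ * sumℚ q
holdsC (halfP i)       q p = p i ≡ ½ * sumℚ p

record InstanceC : Set where
  constructor instC
  field
    n   : ℕ
    eqs : List (CEq n)

-- q_1 ≤ q_i for all i (vacuous when there are no variables)
FirstMin : ∀ {n} → (Fin n → ℚ) → Set
FirstMin {zero}  q = ⊤
FirstMin {suc n} q = ∀ (i : Fin (suc n)) → q zero ≤ q i

SolutionC : (y : InstanceC) → (Fin (InstanceC.n y) → ℚ) → (Fin (InstanceC.n y) → ℚ) → Set
SolutionC (instC n eqs) q p =
  All (λ e → holdsC e q p) eqs
  × FirstMin q
  × (∀ (i : Fin n) → 1ℚ ≤ q i)
  × (∀ (i : Fin n) → 1ℚ ≤ p i)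
  × (sumℚ p ≡ sumℚ q)

SolvableC : InstanceC → Set
SolvableC y = Σ (Fin (InstanceC.n y) → ℚ) λ q → Σ (Fin (InstanceC.n y) → ℚ) λ p → SolutionC y q p

-- Problem B is embedded in Problem C by reading each q_i q_j = q_k q_ℓ as
-- q_i p_j = q_k p_ℓ and adding the equations q_i p_0 = q_0 p_i. These force
-- p = (p_0 / q_0) q, and the constraint Σ p = Σ q then forces p = q, so a
-- solution of the C-instance is exactly a solution of the B-instance taken twice.
module Submission where

open import Defs
open import Data.Product using (Σ; _,_)
open import Function.Bundles using (_⇔_; mk⇔)
open import Data.Nat using (zero; suc)
open import Data.Fin using (Fin; zero; suc)
open import Data.List using (List; []; _∷_; _++_; map; allFin)
open import Data.List.Relation.Unary.All as All using (All; []; _∷_)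
open import Data.List.Relation.Unary.All.Properties using (map⁺; map⁻; ++⁺; ++⁻ˡ; ++⁻ʳ)
open import Data.List.Membership.Propositional.Properties using (∈-allFin)
open import Data.Maybe using (Maybe; just; nothing)
open import Data.Unit using (tt)
open import Data.Rational using (ℚ; 0ℚ; 1ℚ; _+_; _*_; _≤_; _<_; positive)
open import Data.Rational.Properties
open import Relation.Binary.PropositionalEquality

sumℚ-cong : ∀ {n} {f g : Fin n → ℚ} → (∀ i → f i ≡ g i) → sumℚ f ≡ sumℚ g
sumℚ-cong {zero}  f≗g = refl
sumℚ-cong {suc n} f≗g = cong₂ _+_ (f≗g zero) (sumℚ-cong (λ i → f≗g (suc i)))

sumℚ-*ʳ : ∀ {n} (f : Fin n → ℚ) c → sumℚ (λ i → f i * c) ≡ sumℚ f * c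
sumℚ-*ʳ {zero}  f c = sym (*-zeroˡ c)
sumℚ-*ʳ {suc n} f c = begin
  f zero * c + sumℚ (λ i → f (suc i) * c) ≡⟨ cong (f zero * c +_) (sumℚ-*ʳ (λ i → f (suc i)) c) ⟩
  f zero * c + sumℚ (λ i → f (suc i)) * c ≡⟨ *-distribʳ-+ c (f zero) _ ⟨
  sumℚ f * c                               ∎
  where open ≡-Reasoning

sumℚ-nonNeg : ∀ {n} (f : Fin n → ℚ) → (∀ i → 0ℚ ≤ f i) → 0ℚ ≤ sumℚ f
sumℚ-nonNeg {zero}  f f≥0 = ≤-refl
sumℚ-nonNeg {suc n} f f≥0 =
  +-mono-≤ (f≥0 zero) (sumℚ-nonNeg (λ i → f (suc i)) (λ i → f≥0 (suc i)))

sumℚ-pos : ∀ {n} (f : Fin (suc n) → ℚ) → (∀ i → 0ℚ < f i) → 0ℚ < sumℚ f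
sumℚ-pos f f>0 =
  +-mono-<-≤ (f>0 zero) (sumℚ-nonNeg (λ i → f (suc i)) (λ i → <⇒≤ (f>0 (suc i))))

*-cancelʳ-≡-pos : ∀ {a b} r → 0ℚ < r → a * r ≡ b * r → a ≡ b
*-cancelʳ-≡-pos r r>0 ar≡br = ≤-antisym
  (*-cancelʳ-≤-pos r {{positive r>0}} (≤-reflexive ar≡br))
  (*-cancelʳ-≤-pos r {{positive r>0}} (≤-reflexive (sym ar≡br)))

proportional∧sum≡⇒≡ : ∀ {n} (q p : Fin (suc n) → ℚ) → (∀ i → 0ℚ < q i) →
  (∀ i → q i * p zero ≡ q zero * p i) → sumℚ p ≡ sumℚ q → ∀ i → p i ≡ q i
proportional∧sum≡⇒≡ q p q>0 prop Σp≡Σq i =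
  sym (*-cancelʳ-≡-pos (q zero) (q>0 zero) (begin
    q i * q zero    ≡⟨ cong (q i *_) p₀≡q₀ ⟨
    q i * p zero    ≡⟨ prop i ⟩
    q zero * p i    ≡⟨ *-comm (q zero) (p i) ⟩
    p i * q zero    ∎))
  where
  open ≡-Reasoning
  p₀≡q₀ : p zero ≡ q zero
  p₀≡q₀ = *-cancelʳ-≡-pos (sumℚ q) (sumℚ-pos q q>0) (begin
    p zero * sumℚ q               ≡⟨ *-comm (p zero) _ ⟩
    sumℚ q * p zero               ≡⟨ sumℚ-*ʳ q (p zero) ⟨
    sumℚ (λ i → q i * p zero)     ≡⟨ sumℚ-cong (λ i → trans (prop i) (*-comm (q zero) (p i))) ⟩
    sumℚ (λ i → p i * q zero)     ≡⟨ sumℚ-*ʳ p (q zero) ⟩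
    sumℚ p * q zero               ≡⟨ cong (_* q zero) Σp≡Σq ⟩
    sumℚ q * q zero               ≡⟨ *-comm (sumℚ q) _ ⟩
    q zero * sumℚ q               ∎)

linEqs : ∀ {m} → Maybe (LinEq m) → List (CEq m)
linEqs nothing  = []
linEqs (just α) = linQ α ∷ []

mulEq : ∀ {m} → QuadEq m → CEq m
mulEq (quad i j k l) = mulQP i j k l

proportionalityEq : ∀ {m} → Fin (suc m) → CEq (suc m)
proportionalityEq i = mulQP i zero zero i

reduce : InstanceB → InstanceC
reduce (instB n lin quads) =
  instC (suc n) (linEqs lin ++ map mulEq quads ++ map proportionalityEq (allFin (suc n)))

linEqs-sound : ∀ {m} (lin : Maybe (LinEq m)) {q p} →
  holdsMaybeLin lin q → All (λ e → holdsC e q p) (linEqs lin)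
linEqs-sound nothing  _ = []
linEqs-sound (just α) h = h ∷ []

linEqs-complete : ∀ {m} (lin : Maybe (LinEq m)) {q p} →
  All (λ e → holdsC e q p) (linEqs lin) → holdsMaybeLin lin q
linEqs-complete nothing  []      = tt
linEqs-complete (just α) (h ∷ []) = h

mulEq-sound : ∀ {m} (e : QuadEq m) {q} → holdsQuad e q → holdsC (mulEq e) q q
mulEq-sound (quad i j k l) h = h

mulEq-complete : ∀ {m} (e : QuadEq m) {q p} → (∀ i → p i ≡ q i) →
  holdsC (mulEq e) q p → holdsQuad e q
mulEq-complete (quad i j k l) {q} p≗q h =
  subst₂ (λ x y → q i * x ≡ q k * y) (p≗q j) (p≗q l) h

reduce-sound : ∀ x {q} → SolutionB x q → SolutionC (reduce x) q q
reduce-sound (instB n lin quads) {q} (linH , quadsH , 1≤q₀ , q₀≤q) =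
  ++⁺ (linEqs-sound lin linH)
      (++⁺ (map⁺ (All.map (λ {e} → mulEq-sound e {q}) quadsH))
           (map⁺ (All.tabulate (λ {i} _ → *-comm (q i) (q zero))))) ,
  q₀≤q , 1≤q , 1≤q , refl
  where
  1≤q : ∀ i → 1ℚ ≤ q i
  1≤q i = ≤-trans 1≤q₀ (q₀≤q i)

reduce-complete : ∀ x {q p} → SolutionC (reduce x) q p → SolutionB x q
reduce-complete (instB n lin quads) {q} {p} (eqsH , q₀≤q , 1≤q , _ , Σp≡Σq) =
  linEqs-complete lin linH ,
  All.map (λ {e} → mulEq-complete e p≗q) (map⁻ quadsH) ,
  1≤q zero , q₀≤q
  where
  holds : CEq (suc n) → Set
  holds e = holdsC e q p
  linH : All holds (linEqs lin)
  linH = ++⁻ˡ (linEqs lin) eqsH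
  quadsH : All holds (map mulEq quads)
  quadsH = ++⁻ˡ (map mulEq quads) (++⁻ʳ (linEqs lin) eqsH)
  propH : All (λ i → holds (proportionalityEq i)) (allFin (suc n))
  propH = map⁻ (++⁻ʳ (map mulEq quads) (++⁻ʳ (linEqs lin) eqsH))
  p≗q : ∀ i → p i ≡ q i
  p≗q = proportional∧sum≡⇒≡ q p (λ i → <-≤-trans (positive⁻¹ 1ℚ) (1≤q i))
    (λ i → All.lookup propH (∈-allFin i)) Σp≡Σq

lemma12 : Σ (InstanceB → InstanceC) (λ f → ∀ (x : InstanceB) → SolvableB x ⇔ SolvableC (f x))
lemma12 = reduce , λ x →
  mk⇔ (λ (q , sol) → q , q , reduce-sound x sol)
      (λ (q , p , sol) → q , reduce-complete x sol)
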